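{- Let $N$ be a positive integer that is not a perfect square, with continued fraction expansion $\sqrt N=[a_0;\overline{a_1,a_2,\ldots,a_{\tau-1},2a_0}]$ of (minimal) period length $\tau$. For $m\ge1$ let $\Lambda_m=(\Delta_m,\,2\Omega_m,\,\Delta_{m-1})\in\mathbb Z^3$, the coefficient triple of the quadratic form $\mathbf f_m(x,y)=\Delta_mx^2+2\Omega_mxy+\Delta_{m-1}y^2$. Then the map $m\mapsto\Lambda_m$ is injective on $\{1,2,\ldots,\tau\}$; that is, the quadratic forms $\mathbf f_1,\ldots,\mathbf f_\tau$ are pairwise distinct.
   Context: $a_0=\lfloor\sqrt N\rfloor$ and $(a_m)_{m\ge 0}$ are the partial quotients of $\sqrt N$. The convergents are defined by $A_{ -1}=1$, $B_{ -1}=0$, $A_0=a_0$, $B_0=1$, and for $m\ge1$: $A_m=a_mA_{m-1}+A_{m-2}$, $B_m=a_mB_{m-1}+B_{m-2}$. For $m\ge -1$, $\Delta_m=A_m^2-NB_m^2$, and for $m\ge0$, $\Omega_m=A_mA_{m-1}-NB_mB_{m-1}$. -}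

module Defs where

open import Data.Nat using (ℕ; zero; suc; _+_; _*_; _∸_; _≤ᵇ_; _/_)
open import Data.Bool using (if_then_else_)
open import Data.Integer as ℤ using (ℤ; +_)
open import Data.Product using (_×_; _,_)

isqrt : ℕ → ℕ
isqrt zero = zero
isqrt (suc n) with isqrt n
... | r = if (suc r * suc r) ≤ᵇ suc n then suc r else r

-- total division (m div 0 = 0); only ever used with positive divisors
_div_ : ℕ → ℕ → ℕ
m div zero = zero
m div suc k = m / suc k

-- Complete quotients of √N: ξ_m = (P_m + √N) / Q_m, with P_0 = 0, Q_0 = 1.
-- ξ_{m+1} = 1/(ξ_m - a_m) gives P_{m+1} = a_m Q_m - P_m,
-- Q_{m+1} = (N - P_{m+1}^2) / Q_m, and a_m = ⌊ξ_m⌋ = ⌊(P_m + ⌊√N⌋)/Q_m⌋.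
record PQ : Set where
  constructor pq
  field
    P Q : ℕ

PQ-step : ℕ → PQ → PQ
PQ-step N (pq P Q) =
  let a  = (P + isqrt N) div Q
      P' = a * Q ∸ P
  in pq P' ((N ∸ P' * P') div Q)

PQs : ℕ → ℕ → PQ
PQs N zero = pq 0 1
PQs N (suc m) = PQ-step N (PQs N m)

pquot : ℕ → ℕ → ℕ
pquot N m with PQs N m
... | pq P Q = (P + isqrt N) div Q

-- shifted convergents: A' N n = A_{n-1}, B' N n = B_{n-1}  (n ≥ 0, i.e. index ≥ -1)
A' : ℕ → ℕ → ℕ
A' N zero = 1
A' N (suc zero) = pquot N 0
A' N (suc (suc k)) = pquot N (suc k) * A' N (suc k) + A' N k

B' : ℕ → ℕ → ℕ
B' N zero = 0
B' N (suc zero) = 1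
B' N (suc (suc k)) = pquot N (suc k) * B' N (suc k) + B' N k

A B : ℕ → ℕ → ℤ
A N m = + A' N (suc m)
B N m = + B' N (suc m)

-- Δ_{n-1} = A_{n-1}^2 - N B_{n-1}^2  (shifted so Δ' N 0 = Δ_{-1})
Δ' : ℕ → ℕ → ℤ
Δ' N n = (+ A' N n) ℤ.* (+ A' N n) ℤ.- (+ N) ℤ.* ((+ B' N n) ℤ.* (+ B' N n))

Δ : ℕ → ℕ → ℤ
Δ N m = Δ' N (suc m)

Ω : ℕ → ℕ → ℤ
Ω N m = (+ A' N (suc m)) ℤ.* (+ A' N m) ℤ.- (+ N) ℤ.* ((+ B' N (suc m)) ℤ.* (+ B' N m))

Λ : ℕ → ℕ → ℤ × ℤ × ℤ
Λ N m = Δ N m , (+ 2) ℤ.* Ω N m , Δ' N m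

IsPeriod : ℕ → ℕ → Set
IsPeriod N τ = 1 Data.Nat.≤ τ × (∀ m → 1 Data.Nat.≤ m → pquot N (m + τ) Relation.Binary.PropositionalEquality.≡ pquot N m)
  where import Relation.Binary.PropositionalEquality

open import Relation.Binary.PropositionalEquality using (_≡_)
open import Relation.Nullary using (¬_)
open import Data.Nat using (_≤_; _<_)

IsMinPeriod : ℕ → ℕ → Set
IsMinPeriod N τ = IsPeriod N τ × (∀ t → 1 ≤ t → t < τ → ¬ IsPeriod N t)

NonSquare : ℕ → Set
NonSquare N = ∀ k → ¬ (k * k ≡ N)

module Submission where

-- Write ξ_m = (P_m + √N)/Q_m for the complete quotients of √N. Along the expansion the states stay reduced
-- (P_m ≤ ⌊√N⌋, 1 ≤ Q_m ≤ P_m + ⌊√N⌋, N = Q_{m-1} Q_m + P_m²), which keeps every division of the algorithm exact,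
-- and induction along the convergent recurrences gives Δ_{m-1} = (−1)^m Q_m and Ω_m = (−1)^m P_{m+1}.
-- Hence Λ_m determines ξ_{m+1}. If Λ_i = Λ_j with 1 ≤ i < j ≤ τ, the expansion repeats after j − i < τ steps,
-- so j − i would be a shorter period.

open import Defs
open import Data.Nat using (ℕ; _≤_; _<_)
open import Relation.Binary.PropositionalEquality using (_≡_)

open import Data.Nat using (zero; suc; _+_; _*_; _∸_; _≤ᵇ_; _/_; _%_; z≤n; s≤s)
open import Data.Nat.Properties
open import Data.Nat.DivMod using (m≡m%n+[m/n]*n; m%n<n; m/n*n≤m; m*n/n≡m)
open import Data.Integer as ℤ using (ℤ; +_; -[1+_]; -1ℤ; ∣_∣)
import Data.Integer.Properties as ℤ
import Data.Integer.Tactic.RingSolver as ℤ-Ring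
import Data.Nat.Tactic.RingSolver as ℕ-Ring
open import Data.Bool using (true; false; T)
open import Data.Product using (_×_; _,_; proj₁; proj₂)
open import Data.Sum using (inj₁; inj₂)
open import Function using (_∘_)
open import Relation.Binary.PropositionalEquality
  using (_≢_; refl; sym; trans; cong; cong₂; subst; module ≡-Reasoning)

isqrt-bounds : ∀ n → isqrt n * isqrt n ≤ n × n < suc (isqrt n) * suc (isqrt n)
isqrt-bounds zero = z≤n , s≤s z≤n
isqrt-bounds (suc n) with isqrt n | isqrt-bounds n
... | r | (r²≤n , n<[1+r]²) with suc r * suc r ≤ᵇ suc n in eq
... | true = ≤ᵇ⇒≤ _ _ (subst T (sym eq) _)
           , ≤-<-trans n<[1+r]² (*-mono-< (n<1+n (suc r)) (n<1+n (suc r)))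
... | false = ≤-trans r²≤n (n≤1+n n) , ≰⇒> (λ le → subst T eq (≤⇒≤ᵇ le))

div-bounds : ∀ m {q} → 1 ≤ q → m div q * q ≤ m × m < m div q * q + q
div-bounds m {suc k} _ =
  m/n*n≤m m (suc k) ,
  (begin-strict
    m                               ≡⟨ m≡m%n+[m/n]*n m (suc k) ⟩
    m % suc k + m / suc k * suc k   <⟨ +-monoˡ-< _ (m%n<n m (suc k)) ⟩
    suc k + m / suc k * suc k       ≡⟨ +-comm (suc k) _ ⟩
    m / suc k * suc k + suc k       ∎)
  where open ≤-Reasoning

exact-quotient : ∀ {q n} X → 1 ≤ q → + q ℤ.* X ≡ + n → X ≡ + (n div q) × q * (n div q) ≡ n
exact-quotient {suc k} {n} (+ x) _ qX≡n = cong +_ (sym n/q≡x) , trans (cong (suc k *_) n/q≡x) qx≡n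
  where
  qx≡n : suc k * x ≡ n
  qx≡n = ℤ.+-injective (trans (ℤ.pos-* (suc k) x) qX≡n)
  n/q≡x : n / suc k ≡ x
  n/q≡x = trans (cong (_/ suc k) (trans (sym qx≡n) (*-comm (suc k) x))) (m*n/n≡m x (suc k))
exact-quotient {suc k} -[1+ x ] _ ()

pos-∸ : ∀ {m n} → n ≤ m → + (m ∸ n) ≡ + m ℤ.- + n
pos-∸ {m} {n} n≤m = sym (trans (ℤ.m-n≡m⊖n m n) (ℤ.⊖-≥ n≤m))

pos-*+ : ∀ a x y → + (a * x + y) ≡ + a ℤ.* + x ℤ.+ + y
pos-*+ a x y = trans (ℤ.pos-+ (a * x) y) (cong (ℤ._+ + y) (ℤ.pos-* a x))

∣-1^n*i∣≡∣i∣ : ∀ n i → ∣ -1ℤ ℤ.^ n ℤ.* i ∣ ≡ ∣ i ∣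
∣-1^n*i∣≡∣i∣ zero i = cong ∣_∣ (ℤ.*-identityˡ i)
∣-1^n*i∣≡∣i∣ (suc n) i = begin
  ∣ -1ℤ ℤ.* -1ℤ ℤ.^ n ℤ.* i ∣  ≡⟨ cong ∣_∣ (trans (ℤ.*-assoc -1ℤ (-1ℤ ℤ.^ n) i) (ℤ.-1*i≡-i (-1ℤ ℤ.^ n ℤ.* i))) ⟩
  ∣ ℤ.- (-1ℤ ℤ.^ n ℤ.* i) ∣    ≡⟨ ℤ.∣-i∣≡∣i∣ (-1ℤ ℤ.^ n ℤ.* i) ⟩
  ∣ -1ℤ ℤ.^ n ℤ.* i ∣          ≡⟨ ∣-1^n*i∣≡∣i∣ n i ⟩
  ∣ i ∣                        ∎
  where open ≡-Reasoning

-- q' = (N − p²)/q < ((r+1)² − p²)/(r+1−p) = r + 1 + p.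
cofactor-bound : ∀ {N p q q' r} → p ≤ r → r < p + q → N < suc r * suc r →
                 q * q' + p * p ≡ N → q' ≤ p + r
cofactor-bound {N} {p} {q} {q'} {r} p≤r r<p+q N<[1+r]² qq'+p²≡N =
  ≮⇒≥ λ p+r<q' → <-irrefl refl (<-≤-trans N<[1+r]² ([1+r]²≤N p+r<q'))
  where
  t : ℕ
  t = suc r ∸ p
  p+t≡1+r : p + t ≡ suc r
  p+t≡1+r = m+[n∸m]≡n (m≤n⇒m≤1+n p≤r)
  t≤q : t ≤ q
  t≤q = +-cancelˡ-≤ p t q (subst (_≤ p + q) (sym p+t≡1+r) r<p+q)
  square-split : ∀ p t → (p + t) * (p + t) ≡ t * (p + (p + t)) + p * p
  square-split = ℕ-Ring.solve-∀
  [1+r]²≤N : p + r < q' → suc r * suc r ≤ N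
  [1+r]²≤N p+r<q' = begin
    suc r * suc r           ≡⟨ cong₂ _*_ (sym p+t≡1+r) (sym p+t≡1+r) ⟩
    (p + t) * (p + t)       ≡⟨ square-split p t ⟩
    t * (p + (p + t)) + p * p
      ≤⟨ +-monoˡ-≤ (p * p) (*-mono-≤ t≤q (subst (_≤ q') p+[p+t]≡1+p+r p+r<q')) ⟩
    q * q' + p * p          ≡⟨ qq'+p²≡N ⟩
    N                       ∎
    where
    open ≤-Reasoning
    p+[p+t]≡1+p+r : suc (p + r) ≡ p + (p + t)
    p+[p+t]≡1+p+r = trans (sym (+-suc p r)) (cong (_+_ p) (sym p+t≡1+r))

Δ'-rec : ∀ N m → let a = + pquot N (suc m) in
         Δ' N (suc (suc m)) ≡ a ℤ.* a ℤ.* Δ' N (suc m) ℤ.+ (a ℤ.+ a) ℤ.* Ω N m ℤ.+ Δ' N m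
Δ'-rec N m = trans (cong₂ (λ x y → x ℤ.* x ℤ.- + N ℤ.* (y ℤ.* y)) (pos-*+ a A₁ A₀) (pos-*+ a B₁ B₀))
                   (norm-expand (+ N) (+ a) (+ A₁) (+ A₀) (+ B₁) (+ B₀))
  where
  a A₁ A₀ B₁ B₀ : ℕ
  a = pquot N (suc m)
  A₁ = A' N (suc m)
  A₀ = A' N m
  B₁ = B' N (suc m)
  B₀ = B' N m
  norm-expand : ∀ n a x x₀ y y₀ →
    (a ℤ.* x ℤ.+ x₀) ℤ.* (a ℤ.* x ℤ.+ x₀) ℤ.- n ℤ.* ((a ℤ.* y ℤ.+ y₀) ℤ.* (a ℤ.* y ℤ.+ y₀))
      ≡ a ℤ.* a ℤ.* (x ℤ.* x ℤ.- n ℤ.* (y ℤ.* y)) ℤ.+ (a ℤ.+ a) ℤ.* (x ℤ.* x₀ ℤ.- n ℤ.* (y ℤ.* y₀))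
        ℤ.+ (x₀ ℤ.* x₀ ℤ.- n ℤ.* (y₀ ℤ.* y₀))
  norm-expand = ℤ-Ring.solve-∀

Ω-rec : ∀ N m → Ω N (suc m) ≡ + pquot N (suc m) ℤ.* Δ' N (suc m) ℤ.+ Ω N m
Ω-rec N m = trans (cong₂ (λ x y → x ℤ.* + A₁ ℤ.- + N ℤ.* (y ℤ.* + B₁)) (pos-*+ a A₁ A₀) (pos-*+ a B₁ B₀))
                  (polar-expand (+ N) (+ a) (+ A₁) (+ A₀) (+ B₁) (+ B₀))
  where
  a A₁ A₀ B₁ B₀ : ℕ
  a = pquot N (suc m)
  A₁ = A' N (suc m)
  A₀ = A' N m
  B₁ = B' N (suc m)
  B₀ = B' N m
  polar-expand : ∀ n a x x₀ y y₀ →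
    (a ℤ.* x ℤ.+ x₀) ℤ.* x ℤ.- n ℤ.* ((a ℤ.* y ℤ.+ y₀) ℤ.* y)
      ≡ a ℤ.* (x ℤ.* x ℤ.- n ℤ.* (y ℤ.* y)) ℤ.+ (x ℤ.* x₀ ℤ.- n ℤ.* (y ℤ.* y₀))
  polar-expand = ℤ-Ring.solve-∀

PeriodicFrom : {A : Set} → (ℕ → A) → ℕ → ℕ → Set
PeriodicFrom f s d = ∀ m → s ≤ m → f (m + d) ≡ f m

module _ {A : Set} {f : ℕ → A} where

  periodicFrom-* : ∀ {s d} → PeriodicFrom f s d → ∀ k → PeriodicFrom f s (k * d)
  periodicFrom-* per zero m _ = cong f (+-identityʳ m)
  periodicFrom-* {s} {d} per (suc k) m s≤m = begin
    f (m + (d + k * d))  ≡⟨ cong f (trans (cong (_+_ m) (+-comm d (k * d))) (sym (+-assoc m (k * d) d))) ⟩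
    f (m + k * d + d)    ≡⟨ per (m + k * d) (≤-trans s≤m (m≤m+n m (k * d))) ⟩
    f (m + k * d)        ≡⟨ periodicFrom-* per k m s≤m ⟩
    f m                  ∎
    where open ≡-Reasoning

  -- Move m along the period τ past t, where d is known to be a period.
  periodicFrom-backward : ∀ {s d τ t} → 1 ≤ τ → PeriodicFrom f s τ → PeriodicFrom f t d → PeriodicFrom f s d
  periodicFrom-backward {s} {d} {τ} {t} 1≤τ τ-per d-per m s≤m = begin
    f (m + d)              ≡⟨ sym (periodicFrom-* τ-per t (m + d) (≤-trans s≤m (m≤m+n m d))) ⟩
    f (m + d + t * τ)      ≡⟨ cong f (+-swapʳ m d (t * τ)) ⟩
    f (m + t * τ + d)      ≡⟨ d-per (m + t * τ) t≤m+tτ ⟩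
    f (m + t * τ)          ≡⟨ periodicFrom-* τ-per t m s≤m ⟩
    f m                    ∎
    where
    open ≡-Reasoning
    +-swapʳ : ∀ x y z → x + y + z ≡ x + z + y
    +-swapʳ = ℕ-Ring.solve-∀
    t≤m+tτ : t ≤ m + t * τ
    t≤m+tτ = ≤-trans (subst (_≤ t * τ) (*-identityʳ t) (*-monoʳ-≤ t 1≤τ)) (m≤n+m (t * τ) m)

module Expansion (N : ℕ) (nonsquare : NonSquare N) where

  r : ℕ
  r = isqrt N

  r²≤N : r * r ≤ N
  r²≤N = proj₁ (isqrt-bounds N)

  N<[1+r]² : N < suc r * suc r
  N<[1+r]² = proj₂ (isqrt-bounds N)

  1≤r : 1 ≤ r
  1≤r = n≢0⇒n>0 λ r≡0 → nonsquare 0 (sym (n<1⇒n≡0 (subst (λ x → N < suc x * suc x) r≡0 N<[1+r]²)))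

  record Reduced (q₋ p q : ℕ) : Set where
    field
      p≤r : p ≤ r
      1≤q : 1 ≤ q
      q≤p+r : q ≤ p + r
      q₋q+p²≡N : q₋ * q + p * p ≡ N

  module Next {q₋ p q : ℕ} (R : Reduced q₋ p q) where
    open Reduced R

    a p' q' : ℕ
    a = (p + r) div q
    p' = a * q ∸ p
    q' = (N ∸ p' * p') div q

    aq≤p+r : a * q ≤ p + r
    aq≤p+r = proj₁ (div-bounds (p + r) 1≤q)

    p+r<aq+q : p + r < a * q + q
    p+r<aq+q = proj₂ (div-bounds (p + r) 1≤q)

    q≤aq : q ≤ a * q
    q≤aq = subst (_≤ a * q) (*-identityˡ q) (*-monoˡ-≤ q 1≤a)
      where
      1≤a : 1 ≤ a
      1≤a = n≢0⇒n>0 λ a≡0 → <⇒≱ (subst (λ x → p + r < x * q + q) a≡0 p+r<aq+q) q≤p+r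

    p≤aq : p ≤ a * q
    p≤aq with ≤-<-connex p q
    ... | inj₁ p≤q = ≤-trans p≤q q≤aq
    ... | inj₂ q<p = ≮⇒≥ λ aq<p → <-asym p+r<aq+q (<-≤-trans (+-mono-< aq<p q<p) (+-monoʳ-≤ p p≤r))

    p'+p≡aq : p' + p ≡ a * q
    p'+p≡aq = m∸n+n≡m p≤aq

    p'≤r : p' ≤ r
    p'≤r = ≤-trans (∸-monoˡ-≤ p aq≤p+r) (≤-reflexive (m+n∸m≡n p r))

    r<p'+q : r < p' + q
    r<p'+q = +-cancelˡ-< p r (p' + q) (subst (p + r <_) aq+q≡p+[p'+q] p+r<aq+q)
      where
      aq+q≡p+[p'+q] : a * q + q ≡ p + (p' + q)
      aq+q≡p+[p'+q] = trans (cong (_+ q) (trans (sym p'+p≡aq) (+-comm p' p))) (+-assoc p p' q)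

    p'²≤N : p' * p' ≤ N
    p'²≤N = ≤-trans (*-mono-≤ p'≤r p'≤r) r²≤N

    P-relation : + p' ≡ + a ℤ.* + q ℤ.- + p
    P-relation = trans (pos-∸ p≤aq) (cong (ℤ._- + p) (ℤ.pos-* a q))

    -- The classical recurrence Q_{m+1} = Q_{m-1} + 2 a_m P_m − a_m² Q_m; it shows that the division defining q' is exact.
    cofactor : ℤ
    cofactor = + q₋ ℤ.+ (+ a ℤ.* + p ℤ.+ + a ℤ.* + p) ℤ.- + a ℤ.* + a ℤ.* + q

    q*cofactor : + q ℤ.* cofactor ≡ + (N ∸ p' * p')
    q*cofactor = begin
      + q ℤ.* cofactor
        ≡⟨ expand (+ q) (+ q₋) (+ a) (+ p) ⟩
      (+ q₋ ℤ.* + q ℤ.+ + p ℤ.* + p) ℤ.- (+ a ℤ.* + q ℤ.- + p) ℤ.* (+ a ℤ.* + q ℤ.- + p)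
        ≡⟨ cong₂ (λ u v → u ℤ.- v ℤ.* v) (sym q₋q+p²) (sym P-relation) ⟩
      + (q₋ * q + p * p) ℤ.- + p' ℤ.* + p'
        ≡⟨ cong₂ ℤ._-_ (cong +_ q₋q+p²≡N) (sym (ℤ.pos-* p' p')) ⟩
      + N ℤ.- + (p' * p')
        ≡⟨ sym (pos-∸ p'²≤N) ⟩
      + (N ∸ p' * p') ∎
      where
      open ≡-Reasoning
      expand : ∀ q q₋ a p → q ℤ.* (q₋ ℤ.+ (a ℤ.* p ℤ.+ a ℤ.* p) ℤ.- a ℤ.* a ℤ.* q)
                          ≡ (q₋ ℤ.* q ℤ.+ p ℤ.* p) ℤ.- (a ℤ.* q ℤ.- p) ℤ.* (a ℤ.* q ℤ.- p)
      expand = ℤ-Ring.solve-∀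
      q₋q+p² : + (q₋ * q + p * p) ≡ + q₋ ℤ.* + q ℤ.+ + p ℤ.* + p
      q₋q+p² = trans (pos-*+ q₋ q (p * p)) (cong (ℤ._+_ (+ q₋ ℤ.* + q)) (ℤ.pos-* p p))

    Q-relation : + q' ≡ cofactor
    Q-relation = sym (proj₁ (exact-quotient cofactor 1≤q q*cofactor))

    qq'+p'²≡N : q * q' + p' * p' ≡ N
    qq'+p'²≡N = trans (cong (_+ p' * p') (proj₂ (exact-quotient cofactor 1≤q q*cofactor)))
                      (m∸n+n≡m p'²≤N)

    1≤q' : 1 ≤ q'
    1≤q' = n≢0⇒n>0 λ q'≡0 → nonsquare p' (begin
      p' * p'           ≡⟨ cong (_+ p' * p') (sym (trans (cong (q *_) q'≡0) (*-zeroʳ q))) ⟩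
      q * q' + p' * p'  ≡⟨ qq'+p'²≡N ⟩
      N                 ∎)
      where open ≡-Reasoning

    reduced : Reduced q p' q'
    reduced = record
      { p≤r = p'≤r
      ; 1≤q = 1≤q'
      ; q≤p+r = cofactor-bound p'≤r r<p'+q N<[1+r]² qq'+p'²≡N
      ; q₋q+p²≡N = qq'+p'²≡N
      }

  P Q : ℕ → ℕ
  P m = PQ.P (PQs N m)
  Q m = PQ.Q (PQs N m)

  -- Q₋ m plays the role of Q_{m-1}; the value N at m = 0 makes N = Q₋ m Q m + P m² hold from the start.
  Q₋ : ℕ → ℕ
  Q₋ zero = N
  Q₋ (suc m) = Q m

  reduced : ∀ m → Reduced (Q₋ m) (P m) (Q m)
  reduced zero = record
    { p≤r = z≤n ; 1≤q = ≤-refl ; q≤p+r = 1≤r ; q₋q+p²≡N = trans (+-identityʳ (N * 1)) (*-identityʳ N) }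
  reduced (suc m) = Next.reduced (reduced m)

  P-rec : ∀ m → + P (suc m) ≡ + pquot N m ℤ.* + Q m ℤ.- + P m
  P-rec m = Next.P-relation (reduced m)

  Q-rec : ∀ m → + Q (suc m) ≡ + Q₋ m ℤ.+ (+ pquot N m ℤ.* + P m ℤ.+ + pquot N m ℤ.* + P m)
                                 ℤ.- + pquot N m ℤ.* + pquot N m ℤ.* + Q m
  Q-rec m = Next.Q-relation (reduced m)

  Δ'-sign : ∀ m → Δ' N m ≡ -1ℤ ℤ.^ m ℤ.* + Q m
  Ω-sign : ∀ m → Ω N m ≡ -1ℤ ℤ.^ m ℤ.* + P (suc m)

  Δ'-sign zero = cong (ℤ._-_ (+ 1)) (ℤ.*-zeroʳ (+ N))
  Δ'-sign (suc zero) = trans (base (+ pquot N 0) (+ N)) (cong (-1ℤ ℤ.* + 1 ℤ.*_) (sym (Q-rec 0)))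
    where
    base : ∀ a n → a ℤ.* a ℤ.- n ℤ.* (+ 1 ℤ.* + 1)
                 ≡ -1ℤ ℤ.* + 1 ℤ.* (n ℤ.+ (a ℤ.* + 0 ℤ.+ a ℤ.* + 0) ℤ.- a ℤ.* a ℤ.* + 1)
    base = ℤ-Ring.solve-∀
  Δ'-sign (suc (suc m)) = begin
    Δ' N (2 + m)
      ≡⟨ Δ'-rec N m ⟩
    a ℤ.* a ℤ.* Δ' N (1 + m) ℤ.+ (a ℤ.+ a) ℤ.* Ω N m ℤ.+ Δ' N m
      ≡⟨ cong₂ (λ u v → a ℤ.* a ℤ.* u ℤ.+ (a ℤ.+ a) ℤ.* v ℤ.+ Δ' N m) (Δ'-sign (suc m)) (Ω-sign m) ⟩
    a ℤ.* a ℤ.* (-1ℤ ℤ.* σ ℤ.* + Q (1 + m)) ℤ.+ (a ℤ.+ a) ℤ.* (σ ℤ.* + P (1 + m)) ℤ.+ Δ' N m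
      ≡⟨ cong (λ w → a ℤ.* a ℤ.* (-1ℤ ℤ.* σ ℤ.* + Q (1 + m)) ℤ.+ (a ℤ.+ a) ℤ.* (σ ℤ.* + P (1 + m)) ℤ.+ w) (Δ'-sign m) ⟩
    a ℤ.* a ℤ.* (-1ℤ ℤ.* σ ℤ.* + Q (1 + m)) ℤ.+ (a ℤ.+ a) ℤ.* (σ ℤ.* + P (1 + m)) ℤ.+ σ ℤ.* + Q m
      ≡⟨ collect a σ (+ Q m) (+ P (1 + m)) (+ Q (1 + m)) ⟩
    -1ℤ ℤ.* (-1ℤ ℤ.* σ) ℤ.* (+ Q m ℤ.+ (a ℤ.* + P (1 + m) ℤ.+ a ℤ.* + P (1 + m)) ℤ.- a ℤ.* a ℤ.* + Q (1 + m))
      ≡⟨ cong (-1ℤ ℤ.* (-1ℤ ℤ.* σ) ℤ.*_) (sym (Q-rec (suc m))) ⟩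
    -1ℤ ℤ.^ (2 + m) ℤ.* + Q (2 + m) ∎
    where
    open ≡-Reasoning
    a σ : ℤ
    a = + pquot N (suc m)
    σ = -1ℤ ℤ.^ m
    collect : ∀ a σ q₀ p₁ q₁ →
      a ℤ.* a ℤ.* (-1ℤ ℤ.* σ ℤ.* q₁) ℤ.+ (a ℤ.+ a) ℤ.* (σ ℤ.* p₁) ℤ.+ σ ℤ.* q₀
        ≡ -1ℤ ℤ.* (-1ℤ ℤ.* σ) ℤ.* (q₀ ℤ.+ (a ℤ.* p₁ ℤ.+ a ℤ.* p₁) ℤ.- a ℤ.* a ℤ.* q₁)
    collect = ℤ-Ring.solve-∀

  Ω-sign zero = trans (base (+ pquot N 0) (+ N)) (cong (+ 1 ℤ.*_) (sym (P-rec 0)))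
    where
    base : ∀ a n → a ℤ.* + 1 ℤ.- n ℤ.* (+ 1 ℤ.* + 0) ≡ + 1 ℤ.* (a ℤ.* + 1 ℤ.- + 0)
    base = ℤ-Ring.solve-∀
  Ω-sign (suc m) = begin
    Ω N (1 + m)
      ≡⟨ Ω-rec N m ⟩
    a ℤ.* Δ' N (1 + m) ℤ.+ Ω N m
      ≡⟨ cong₂ (λ u v → a ℤ.* u ℤ.+ v) (Δ'-sign (suc m)) (Ω-sign m) ⟩
    a ℤ.* (-1ℤ ℤ.* σ ℤ.* + Q (1 + m)) ℤ.+ σ ℤ.* + P (1 + m)
      ≡⟨ collect a σ (+ P (1 + m)) (+ Q (1 + m)) ⟩
    -1ℤ ℤ.* σ ℤ.* (a ℤ.* + Q (1 + m) ℤ.- + P (1 + m))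
      ≡⟨ cong (-1ℤ ℤ.* σ ℤ.*_) (sym (P-rec (suc m))) ⟩
    -1ℤ ℤ.^ (1 + m) ℤ.* + P (2 + m) ∎
    where
    open ≡-Reasoning
    a σ : ℤ
    a = + pquot N (suc m)
    σ = -1ℤ ℤ.^ m
    collect : ∀ a σ p₁ q₁ → a ℤ.* (-1ℤ ℤ.* σ ℤ.* q₁) ℤ.+ σ ℤ.* p₁ ≡ -1ℤ ℤ.* σ ℤ.* (a ℤ.* q₁ ℤ.- p₁)
    collect = ℤ-Ring.solve-∀

  ∣Δ∣≡Q : ∀ m → ∣ Δ N m ∣ ≡ Q (suc m)
  ∣Δ∣≡Q m = trans (cong ∣_∣ (Δ'-sign (suc m))) (∣-1^n*i∣≡∣i∣ (suc m) (+ Q (suc m)))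

  ∣Ω∣≡P : ∀ m → ∣ Ω N m ∣ ≡ P (suc m)
  ∣Ω∣≡P m = trans (cong ∣_∣ (Ω-sign m)) (∣-1^n*i∣≡∣i∣ m (+ P (suc m)))

  Λ-determines-PQs : ∀ i j → Λ N i ≡ Λ N j → PQs N (suc i) ≡ PQs N (suc j)
  Λ-determines-PQs i j Λi≡Λj = cong₂ pq
    (trans (sym (∣Ω∣≡P i)) (trans (cong ∣_∣ Ωi≡Ωj) (∣Ω∣≡P j)))
    (trans (sym (∣Δ∣≡Q i)) (trans (cong (∣_∣ ∘ proj₁) Λi≡Λj) (∣Δ∣≡Q j)))
    where
    Ωi≡Ωj : Ω N i ≡ Ω N j
    Ωi≡Ωj = ℤ.*-cancelˡ-≡ (+ 2) (Ω N i) (Ω N j) (cong (proj₁ ∘ proj₂) Λi≡Λj)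

pquot-PQs : ∀ N {m n} → PQs N m ≡ PQs N n → pquot N m ≡ pquot N n
pquot-PQs N = cong (λ s → (PQ.P s + isqrt N) div PQ.Q s)

PQs-shift : ∀ N k {m n} → PQs N m ≡ PQs N n → PQs N (k + m) ≡ PQs N (k + n)
PQs-shift N zero same = same
PQs-shift N (suc k) same = cong (PQ-step N) (PQs-shift N k same)

pquot-periodicFrom : ∀ N s d → PQs N s ≡ PQs N (s + d) → PeriodicFrom (pquot N) s d
pquot-periodicFrom N s d same m s≤m = begin
  pquot N (m + d)            ≡⟨ cong (λ x → pquot N (x + d)) (sym k+s≡m) ⟩
  pquot N (k + s + d)        ≡⟨ cong (pquot N) (+-assoc k s d) ⟩
  pquot N (k + (s + d))      ≡⟨ sym (pquot-PQs N (PQs-shift N k same)) ⟩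
  pquot N (k + s)            ≡⟨ cong (pquot N) k+s≡m ⟩
  pquot N m                  ∎
  where
  open ≡-Reasoning
  k : ℕ
  k = m ∸ s
  k+s≡m : k + s ≡ m
  k+s≡m = m∸n+n≡m s≤m

states-distinct : ∀ {N τ i j} → IsMinPeriod N τ → 1 ≤ i → i < j → j ≤ τ → PQs N (suc i) ≢ PQs N (suc j)
states-distinct {N} {τ} {i} {j} ((1≤τ , τ-period) , minimal) 1≤i i<j j≤τ same =
  minimal d 1≤d d<τ (1≤d , periodicFrom-backward 1≤τ τ-period d-period-from-i)
  where
  d : ℕ
  d = j ∸ i
  i+d≡j : i + d ≡ j
  i+d≡j = m+[n∸m]≡n (<⇒≤ i<j)
  1≤d : 1 ≤ d
  1≤d = m<n⇒0<n∸m i<j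
  d<τ : d < τ
  d<τ = <-≤-trans (m<n+m d 1≤i) (subst (_≤ τ) (sym i+d≡j) j≤τ)
  d-period-from-i : PeriodicFrom (pquot N) (suc i) d
  d-period-from-i = pquot-periodicFrom N (suc i) d (trans same (cong (PQs N ∘ suc) (sym i+d≡j)))

theorem3 : (N : ℕ) → 0 < N → NonSquare N → (τ : ℕ) → IsMinPeriod N τ →
    (i j : ℕ) → 1 ≤ i → i ≤ τ → 1 ≤ j → j ≤ τ → Λ N i ≡ Λ N j → i ≡ j
theorem3 N _ nonsquare τ minimal i j 1≤i i≤τ 1≤j j≤τ Λi≡Λj =
  ≤-antisym (≮⇒≥ λ j<i → states-distinct minimal 1≤j j<i i≤τ (sym same))
            (≮⇒≥ λ i<j → states-distinct minimal 1≤i i<j j≤τ same)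
  where
  same : PQs N (suc i) ≡ PQs N (suc j)
  same = Expansion.Λ-determines-PQs N nonsquare i j Λi≡Λj
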